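{- Let $G$ be the undirected graph with vertex set $\mathbb{N}=\{0,1,2,\ldots\}$ and a single edge $\{i,i+1\}$ for each $i\in\mathbb{N}$. Then for every $n\geq 1$, $G$ sorts $\Delta^n$: there is a unique $G$-stable labeled configuration $\mathcal{D}$ with $\Delta^n \xrightarrow{G}\mathcal{D}$, and $\mathcal{D}(i)\leq \mathcal{D}(j)$ for all $1\leq i\leq j\leq n$.
   Context: Each undirected edge $\{u,v\}$ is treated as two directed edges $(u,v)$ and $(v,u)$, so vertex $0$ has out-degree $1$ and every vertex $v\geq1$ has out-degree $2$. A labeled configuration assigns finitely many chips, labeled by distinct positive integers, to vertices; $\mathcal{C}(i)$ is the vertex of chip $(i)$. $\Delta^n$ has chips $(1),\ldots,(n)$ at vertex $0$. A labeled firing at a vertex $v$ with at least $\mathrm{outdeg}(v)$ chips: at $v=0$, choose one chip at $0$ and move it to $1$; at $v\geq 1$, choose two chips at $v$, move the smaller-labeled one to $v-1$ and the larger-labeled one to $v+1$. $\mathcal{C}\xrightarrow{G}\mathcal{D}$ means reachable by zero or more such firings; $\mathcal{D}$ is $G$-stable if every vertex $v$ holds fewer than $\mathrm{outdeg}(v)$ chips. -}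

module Defs where

open import Data.Nat using (ℕ; zero; suc; _<_; _≟_)
open import Data.Fin as F using (Fin)
open import Data.Vec using (Vec; lookup; replicate; _[_]≔_)
open import Data.List using (length; filter)
open import Relation.Binary.PropositionalEquality using (_≡_)
open import Relation.Binary.Construct.Closure.ReflexiveTransitive using (Star)
import Data.List as L

-- The graph G: vertex set ℕ, edges {i, i+1}.  outdeg 0 = 1, outdeg (v+1) = 2.
outdeg : ℕ → ℕ
outdeg zero    = 1
outdeg (suc _) = 2

-- A labeled configuration with chips (1),…,(n): chip (k+1) is represented by
-- the index k : Fin n, and  lookup C k  is the vertex of that chip.
Config : ℕ → Set
Config n = Vec ℕ n

Δ : (n : ℕ) → Config n
Δ n = replicate n 0

chipsAt : ∀ {n} → Config n → ℕ → ℕ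
chipsAt {n} C v = length (filter (λ i → lookup C i ≟ v) (L.tabulate {n = n} (λ i → i)))

data Fire {n : ℕ} : Config n → Config n → Set where
  fire0 : (C : Config n) (i : Fin n) → lookup C i ≡ 0 →
          Fire C (C [ i ]≔ 1)
  fireS : (C : Config n) (v : ℕ) (i j : Fin n) → i F.< j →
          lookup C i ≡ suc v → lookup C j ≡ suc v →
          Fire C ((C [ i ]≔ v) [ j ]≔ suc (suc v))

_⟶G_ : ∀ {n} → Config n → Config n → Set
_⟶G_ = Star Fire

Stable : ∀ {n} → Config n → Set
Stable C = ∀ v → chipsAt C v < outdeg v

-- The invariant behind the theorem: along any firing sequence from Δⁿ, at most m + 1 − k of the
-- chips (1), …, (m) lie at vertices ≥ k.  A firing at 0 only affects k = 1, where the bound is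
-- trivial.  A firing at v ≥ 1 lowers chip (a) and raises chip (b), a < b, to v + 1; this can only
-- increase the count for k = v + 1 and prefixes containing (b), hence (a), and those prefixes had
-- two chips at v, i.e. room to spare one level up.
-- A configuration is stable exactly when its chips sit at distinct positive vertices.  By the
-- invariant chip (i) lies at a vertex ≤ i, so by induction on i a reachable stable configuration
-- puts chip (i) on vertex i.  One is reached because every firing increases the sum of the squared
-- positions, which the invariant bounds by n³.

module Submission where

open import Defs
open import Data.Nat using (ℕ; zero; suc; pred; _+_; _*_; _∸_; _≤_; _<_; _≥_; z≤n; s≤s; _≟_; _≤?_; _<?_)
open import Data.Nat.Properties
open import Data.Nat.Tactic.RingSolver using (solve-∀)
open import Data.Fin as F using (Fin; toℕ; fromℕ<)
import Data.Fin.Properties as Fin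
open import Data.Fin.Induction using (<-wellFounded)
open import Data.Vec using ([]; _∷_; lookup; tabulate; _[_]≔_)
open import Data.Vec.Properties
  using (lookup∘update′; lookup∘tabulate; tabulate∘lookup; tabulate-cong; lookup-replicate)
import Data.List as List
open import Data.List.Properties using (filter-accept; filter-reject)
open import Data.Product using (Σ; ∃; _×_; _,_)
open import Data.Sum using (_⊎_; inj₁; inj₂)
open import Data.Empty using (⊥-elim)
open import Function using (_∘_; id)
open import Function.Definitions using (Injective)
open import Induction.WellFounded using (module All)
open import Level using (0ℓ)
open import Relation.Nullary using (yes; no)
open import Relation.Nullary.Decidable using (_×-dec_)
open import Relation.Binary.PropositionalEquality
open import Relation.Binary.Construct.Closure.ReflexiveTransitive using (ε; _◅_)
open import Relation.Binary.Definitions using (tri<; tri≈; tri>)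

private
  variable
    n : ℕ

atLeast : ℕ → ℕ → ℕ
atLeast zero    _       = 1
atLeast (suc k) zero    = 0
atLeast (suc k) (suc x) = atLeast k x

at : ℕ → ℕ → ℕ
at zero    zero    = 1
at zero    (suc _) = 0
at (suc v) zero    = 0
at (suc v) (suc x) = at v x

atLeast≤1 : ∀ k x → atLeast k x ≤ 1
atLeast≤1 zero    _       = s≤s z≤n
atLeast≤1 (suc k) zero    = z≤n
atLeast≤1 (suc k) (suc x) = atLeast≤1 k x

atLeast-refl : ∀ k → atLeast k k ≡ 1
atLeast-refl zero    = refl
atLeast-refl (suc k) = atLeast-refl k

atLeast-monoʳ : ∀ k x → atLeast k x ≤ atLeast k (suc x)
atLeast-monoʳ zero    _       = s≤s z≤n
atLeast-monoʳ (suc k) zero    = z≤n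
atLeast-monoʳ (suc k) (suc x) = atLeast-monoʳ k x

atLeast-suc : ∀ k x → k ≢ suc x → atLeast k (suc x) ≤ atLeast k x
atLeast-suc zero          _       _   = s≤s z≤n
atLeast-suc (suc zero)    zero    k≢1 = ⊥-elim (k≢1 refl)
atLeast-suc (suc (suc k)) zero    _   = z≤n
atLeast-suc (suc k)       (suc x) k≢x = atLeast-suc k x (k≢x ∘ cong suc)

atLeast-split : ∀ k x → atLeast k x ≡ atLeast (suc k) x + at k x
atLeast-split zero    zero    = refl
atLeast-split zero    (suc x) = refl
atLeast-split (suc k) zero    = refl
atLeast-split (suc k) (suc x) = atLeast-split k x

at≤1 : ∀ v x → at v x ≤ 1
at≤1 zero    zero    = s≤s z≤n
at≤1 zero    (suc _) = z≤n
at≤1 (suc v) zero    = z≤n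
at≤1 (suc v) (suc x) = at≤1 v x

at-≡ : ∀ v {x} → x ≡ v → at v x ≡ 1
at-≡ zero    refl = refl
at-≡ (suc v) refl = at-≡ v refl

at-≢ : ∀ {v x} → x ≢ v → at v x ≡ 0
at-≢ {zero}  {zero}  x≢v = ⊥-elim (x≢v refl)
at-≢ {zero}  {suc x} _   = refl
at-≢ {suc v} {zero}  _   = refl
at-≢ {suc v} {suc x} x≢v = at-≢ (x≢v ∘ cong suc)

at-pos : ∀ v {x} → 0 < at v x → x ≡ v
at-pos zero    {zero}  _   = refl
at-pos (suc v) {suc x} pos = cong suc (at-pos v pos)

prefixSum : (ℕ → ℕ) → ℕ → Config n → ℕ
prefixSum f zero    _       = 0
prefixSum f (suc m) []      = 0
prefixSum f (suc m) (x ∷ C) = f x + prefixSum f m C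

module _ (f : ℕ → ℕ) where

  prefixSum-update : ∀ m (C : Config n) i a → toℕ i < m →
    prefixSum f m (C [ i ]≔ a) + f (lookup C i) ≡ prefixSum f m C + f a
  prefixSum-update (suc m) (x ∷ C) F.zero    a _         = exchange (f a) _ (f x)
    where
    exchange : ∀ a s b → (a + s) + b ≡ (b + s) + a
    exchange = solve-∀
  prefixSum-update (suc m) (x ∷ C) (F.suc i) a (s≤s i<m) = begin
    (f x + prefixSum f m (C [ i ]≔ a)) + f (lookup C i) ≡⟨ +-assoc (f x) _ _ ⟩
    f x + (prefixSum f m (C [ i ]≔ a) + f (lookup C i)) ≡⟨ cong (f x +_) (prefixSum-update m C i a i<m) ⟩
    f x + (prefixSum f m C + f a)                       ≡⟨ +-assoc (f x) _ _ ⟨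
    (f x + prefixSum f m C) + f a                       ∎
    where open ≡-Reasoning

  prefixSum-update-beyond : ∀ m (C : Config n) i a → m ≤ toℕ i →
    prefixSum f m (C [ i ]≔ a) ≡ prefixSum f m C
  prefixSum-update-beyond zero    _       _         _ _         = refl
  prefixSum-update-beyond (suc m) (x ∷ C) (F.suc i) a (s≤s m≤i) =
    cong (f x +_) (prefixSum-update-beyond m C i a m≤i)

  prefixSum-update-≤ : ∀ m (C : Config n) i a → f a ≤ f (lookup C i) →
    prefixSum f m (C [ i ]≔ a) ≤ prefixSum f m C
  prefixSum-update-≤ m C i a fa≤ with m ≤? toℕ i
  ... | yes m≤i = ≤-reflexive (prefixSum-update-beyond m C i a m≤i)
  ... | no  m≰i = +-cancelʳ-≤ (f (lookup C i)) _ _ (begin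
    prefixSum f m (C [ i ]≔ a) + f (lookup C i) ≡⟨ prefixSum-update m C i a (≰⇒> m≰i) ⟩
    prefixSum f m C + f a                       ≤⟨ +-monoʳ-≤ (prefixSum f m C) fa≤ ⟩
    prefixSum f m C + f (lookup C i)            ∎)
    where open ≤-Reasoning

  prefixSum-update-≤-suc : ∀ m (C : Config n) i a → f a ≤ 1 →
    prefixSum f m (C [ i ]≔ a) ≤ suc (prefixSum f m C)
  prefixSum-update-≤-suc m C i a fa≤1 with m ≤? toℕ i
  ... | yes m≤i = ≤-trans (≤-reflexive (prefixSum-update-beyond m C i a m≤i)) (n≤1+n _)
  ... | no  m≰i = begin
    prefixSum f m (C [ i ]≔ a)                  ≤⟨ m≤m+n _ _ ⟩
    prefixSum f m (C [ i ]≔ a) + f (lookup C i) ≡⟨ prefixSum-update m C i a (≰⇒> m≰i) ⟩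
    prefixSum f m C + f a                       ≤⟨ +-monoʳ-≤ (prefixSum f m C) fa≤1 ⟩
    prefixSum f m C + 1                         ≡⟨ +-comm _ 1 ⟩
    suc (prefixSum f m C)                       ∎
    where open ≤-Reasoning

  prefixSum-≤-* : ∀ m (C : Config n) b → (∀ i → f (lookup C i) ≤ b) → prefixSum f m C ≤ m * b
  prefixSum-≤-* zero    _       _ _     = z≤n
  prefixSum-≤-* (suc m) []      _ _     = z≤n
  prefixSum-≤-* (suc m) (x ∷ C) b bound =
    +-mono-≤ (bound F.zero) (prefixSum-≤-* m C b (bound ∘ F.suc))

  prefixSum-≥-entry : ∀ m (C : Config n) i → toℕ i < m → f (lookup C i) ≤ prefixSum f m C
  prefixSum-≥-entry (suc m) (x ∷ C) F.zero    _         = m≤m+n _ _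
  prefixSum-≥-entry (suc m) (x ∷ C) (F.suc i) (s≤s i<m) =
    ≤-trans (prefixSum-≥-entry m C i i<m) (m≤n+m _ (f x))

  prefixSum-≥-entries : ∀ m (C : Config n) i j → i ≢ j → toℕ i < m → toℕ j < m →
    f (lookup C i) + f (lookup C j) ≤ prefixSum f m C
  prefixSum-≥-entries (suc m) (x ∷ C) F.zero F.zero i≢j _ _ = ⊥-elim (i≢j refl)
  prefixSum-≥-entries (suc m) (x ∷ C) F.zero (F.suc j) _ _ (s≤s j<m) =
    +-monoʳ-≤ (f x) (prefixSum-≥-entry m C j j<m)
  prefixSum-≥-entries (suc m) (x ∷ C) (F.suc i) F.zero _ (s≤s i<m) _ =
    ≤-trans (≤-reflexive (+-comm _ (f x))) (+-monoʳ-≤ (f x) (prefixSum-≥-entry m C i i<m))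
  prefixSum-≥-entries (suc m) (x ∷ C) (F.suc i) (F.suc j) i≢j (s≤s i<m) (s≤s j<m) =
    ≤-trans (prefixSum-≥-entries m C i j (i≢j ∘ cong F.suc) i<m j<m) (m≤n+m _ (f x))

  prefixSum-≤1 : ∀ m (C : Config n) → (∀ x → f x ≤ 1) →
    (∀ {i j} → 0 < f (lookup C i) → 0 < f (lookup C j) → i ≡ j) → prefixSum f m C ≤ 1
  prefixSum-≤1 zero    _       _   _      = z≤n
  prefixSum-≤1 (suc m) []      _   _      = z≤n
  prefixSum-≤1 (suc m) (x ∷ C) f≤1 unique with 0 <? f x
  ... | yes fx>0 =
    +-mono-≤ (f≤1 x) (≤-trans (prefixSum-≤-* m C 0 rest-zero) (≤-reflexive (*-zeroʳ m)))
    where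
    rest-zero : ∀ i → f (lookup C i) ≤ 0
    rest-zero i = ≮⇒≥ (λ fi>0 → Fin.0≢1+n (unique fx>0 fi>0))
  ... | no  fx≯0 =
    +-mono-≤ (≮⇒≥ fx≯0) (prefixSum-≤1 m C f≤1 (λ p q → Fin.suc-injective (unique p q)))

prefixSum-split : ∀ {f g h : ℕ → ℕ} → (∀ x → f x ≡ g x + h x) → ∀ m (C : Config n) →
  prefixSum f m C ≡ prefixSum g m C + prefixSum h m C
prefixSum-split split zero    _       = refl
prefixSum-split split (suc m) []      = refl
prefixSum-split {f = f} {g} {h} split (suc m) (x ∷ C) = begin
  f x + prefixSum f m C                                 ≡⟨ cong₂ _+_ (split x) (prefixSum-split split m C) ⟩
  (g x + h x) + (prefixSum g m C + prefixSum h m C)     ≡⟨ interchange (g x) (h x) _ _ ⟩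
  (g x + prefixSum g m C) + (h x + prefixSum h m C)     ∎
  where
  open ≡-Reasoning
  interchange : ∀ a b c d → (a + b) + (c + d) ≡ (a + c) + (b + d)
  interchange = solve-∀

-- Stable configurations

chipsAt≡prefixSum : (C : Config n) (v : ℕ) → chipsAt C v ≡ prefixSum (at v) n C
chipsAt≡prefixSum {n} C v =
  trans (filter-tabulate id (lookup C)) (cong (prefixSum (at v) n) (tabulate∘lookup C))
  where
  filter-tabulate : ∀ {m} {A : Set} (h : Fin m → A) (g : A → ℕ) →
    List.length (List.filter (λ a → g a ≟ v) (List.tabulate h)) ≡ prefixSum (at v) m (tabulate (g ∘ h))
  filter-tabulate {zero}  h g = refl
  filter-tabulate {suc m} h g with g (h F.zero) ≟ v
  ... | yes hit rewrite filter-accept (λ a → g a ≟ v) {xs = List.tabulate (h ∘ F.suc)} hit | at-≡ v hit =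
    cong suc (filter-tabulate (h ∘ F.suc) g)
  ... | no miss rewrite filter-reject (λ a → g a ≟ v) {xs = List.tabulate (h ∘ F.suc)} miss | at-≢ miss =
    filter-tabulate (h ∘ F.suc) g

Spread : Config n → Set
Spread C = (∀ i → lookup C i ≢ 0) × Injective _≡_ _≡_ (lookup C)

outdeg≤2 : ∀ v → outdeg v ≤ 2
outdeg≤2 zero    = s≤s z≤n
outdeg≤2 (suc v) = ≤-refl

stable⇒spread : {C : Config n} → Stable C → Spread C
stable⇒spread {n} {C} stable = noChipAt0 , injective
  where
  occupied : ∀ i → 1 ≤ chipsAt C (lookup C i)
  occupied i = begin
    1                                   ≡⟨ at-≡ (lookup C i) refl ⟨
    at (lookup C i) (lookup C i)        ≤⟨ prefixSum-≥-entry (at (lookup C i)) n C i (Fin.toℕ<n i) ⟩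
    prefixSum (at (lookup C i)) n C     ≡⟨ chipsAt≡prefixSum C (lookup C i) ⟨
    chipsAt C (lookup C i)              ∎
    where open ≤-Reasoning
  noChipAt0 : ∀ i → lookup C i ≢ 0
  noChipAt0 i ci = <⇒≱ (stable 0) (subst (λ v → 1 ≤ chipsAt C v) ci (occupied i))
  injective : Injective _≡_ _≡_ (lookup C)
  injective {i} {j} same with i Fin.≟ j
  ... | yes i≡j = i≡j
  ... | no  i≢j = ⊥-elim (<⇒≱ (<-≤-trans (stable v) (outdeg≤2 v)) (begin
    2                               ≡⟨ cong₂ _+_ (at-≡ v refl) (at-≡ v (sym same)) ⟨
    at v (lookup C i) + at v (lookup C j) ≤⟨ prefixSum-≥-entries (at v) n C i j i≢j (Fin.toℕ<n i) (Fin.toℕ<n j) ⟩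
    prefixSum (at v) n C            ≡⟨ chipsAt≡prefixSum C v ⟨
    chipsAt C v                     ∎))
    where
    v = lookup C i
    open ≤-Reasoning

spread⇒stable : {C : Config n} → Spread C → Stable C
spread⇒stable {n} {C} (noChipAt0 , _) zero = begin-strict
  chipsAt C 0              ≡⟨ chipsAt≡prefixSum C 0 ⟩
  prefixSum (at 0) n C     ≤⟨ prefixSum-≤-* (at 0) n C 0 (λ i → ≤-reflexive (at-≢ (noChipAt0 i))) ⟩
  n * 0                    ≡⟨ *-zeroʳ n ⟩
  0                        <⟨ s≤s z≤n ⟩
  1                        ∎
  where open ≤-Reasoning
spread⇒stable {n} {C} (_ , injective) (suc v) = begin-strict
  chipsAt C (suc v)          ≡⟨ chipsAt≡prefixSum C (suc v) ⟩
  prefixSum (at (suc v)) n C ≤⟨ prefixSum-≤1 (at (suc v)) n C (at≤1 (suc v))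
                                  (λ p q → injective (trans (at-pos (suc v) p) (sym (at-pos (suc v) q)))) ⟩
  1                          <⟨ s≤s (s≤s z≤n) ⟩
  2                          ∎
  where open ≤-Reasoning

-- The invariant

PrefixBounded : Config n → Set
PrefixBounded C = ∀ m k → prefixSum (atLeast k) m C ≤ suc m ∸ k

prefixSum-atLeast-≤ : ∀ k m (C : Config n) → prefixSum (atLeast k) m C ≤ m
prefixSum-atLeast-≤ k m C =
  ≤-trans (prefixSum-≤-* (atLeast k) m C 1 (atLeast≤1 k ∘ lookup C)) (≤-reflexive (*-identityʳ m))

prefixSum-atLeast-pair : ∀ {k} m (C : Config n) i j → i ≢ j → toℕ i < m → toℕ j < m →
  lookup C i ≡ k → lookup C j ≡ k → 2 + prefixSum (atLeast (suc k)) m C ≤ prefixSum (atLeast k) m C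
prefixSum-atLeast-pair {k = k} m C i j i≢j i<m j<m ci cj = begin
  2 + prefixSum (atLeast (suc k)) m C
    ≡⟨ +-comm 2 _ ⟩
  prefixSum (atLeast (suc k)) m C + 2
    ≡⟨ cong (prefixSum (atLeast (suc k)) m C +_) (cong₂ _+_ (at-≡ k ci) (at-≡ k cj)) ⟨
  prefixSum (atLeast (suc k)) m C + (at k (lookup C i) + at k (lookup C j))
    ≤⟨ +-monoʳ-≤ _ (prefixSum-≥-entries (at k) m C i j i≢j i<m j<m) ⟩
  prefixSum (atLeast (suc k)) m C + prefixSum (at k) m C
    ≡⟨ prefixSum-split (atLeast-split k) m C ⟨
  prefixSum (atLeast k) m C ∎
  where open ≤-Reasoning

prefixBounded-Δ : ∀ n → PrefixBounded (Δ n)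
prefixBounded-Δ n m zero    = m≤n⇒m≤1+n (prefixSum-atLeast-≤ 0 m (Δ n))
prefixBounded-Δ n m (suc k) = ≤-trans
  (prefixSum-≤-* (atLeast (suc k)) m (Δ n) 0
    (λ i → ≤-reflexive (cong (atLeast (suc k)) (lookup-replicate i 0))))
  (≤-trans (≤-reflexive (*-zeroʳ m)) z≤n)

prefixBounded-fireS : ∀ {C : Config n} v i j → toℕ i < toℕ j → lookup C i ≡ suc v → lookup C j ≡ suc v →
  PrefixBounded C → PrefixBounded ((C [ i ]≔ v) [ j ]≔ suc (suc v))
prefixBounded-fireS {C = C} v i j i<j ci cj bounded m = bound
  where
  C₁ = C [ i ]≔ v
  C₂ = C₁ [ j ]≔ suc (suc v)

  i≢j : i ≢ j
  i≢j refl = <-irrefl refl i<j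

  c₁j : lookup C₁ j ≡ suc v
  c₁j = trans (lookup∘update′ (i≢j ∘ sym) C v) cj

  lowered : ∀ k → prefixSum (atLeast k) m C₁ ≤ prefixSum (atLeast k) m C
  lowered k = prefixSum-update-≤ (atLeast k) m C i v
    (subst (λ x → atLeast k v ≤ atLeast k x) (sym ci) (atLeast-monoʳ k v))

  bound : ∀ k → prefixSum (atLeast k) m C₂ ≤ suc m ∸ k
  bound k with k ≟ suc (suc v)
  ... | no k≢v+2 = begin
    prefixSum (atLeast k) m C₂ ≤⟨ prefixSum-update-≤ (atLeast k) m C₁ j (suc (suc v))
                                    (subst (λ x → atLeast k (suc (suc v)) ≤ atLeast k x) (sym c₁j)
                                      (atLeast-suc k (suc v) k≢v+2)) ⟩
    prefixSum (atLeast k) m C₁ ≤⟨ lowered k ⟩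
    prefixSum (atLeast k) m C  ≤⟨ bounded m k ⟩
    suc m ∸ k                  ∎
    where open ≤-Reasoning
  ... | yes refl with m ≤? toℕ j
  ...   | yes m≤j = begin
    prefixSum (atLeast k) m C₂ ≡⟨ prefixSum-update-beyond (atLeast k) m C₁ j (suc (suc v)) m≤j ⟩
    prefixSum (atLeast k) m C₁ ≤⟨ lowered k ⟩
    prefixSum (atLeast k) m C  ≤⟨ bounded m k ⟩
    suc m ∸ k                  ∎
    where open ≤-Reasoning
  ...   | no  m≰j = begin
    prefixSum (atLeast k) m C₂       ≤⟨ prefixSum-update-≤-suc (atLeast k) m C₁ j (suc (suc v))
                                          (atLeast≤1 k (suc (suc v))) ⟩
    suc (prefixSum (atLeast k) m C₁) ≤⟨ s≤s (lowered k) ⟩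
    suc (prefixSum (atLeast k) m C)  ≤⟨ pred-mono-≤ (≤-trans (prefixSum-atLeast-pair m C i j i≢j i<m j<m ci cj)
                                                            (bounded m (suc v))) ⟩
    pred (m ∸ v)                     ≡⟨ pred[m∸n]≡m∸[1+n] m v ⟩
    m ∸ suc v                        ∎
    where
    open ≤-Reasoning
    j<m = ≰⇒> m≰j
    i<m = <-trans i<j j<m

prefixBounded-fire : {C D : Config n} → Fire C D → PrefixBounded C → PrefixBounded D
prefixBounded-fire (fire0 C i _) _ m zero = m≤n⇒m≤1+n (prefixSum-atLeast-≤ 0 m _)
prefixBounded-fire (fire0 C i _) _ m (suc zero) = prefixSum-atLeast-≤ 1 m _
prefixBounded-fire (fire0 C i _) bounded m k@(suc (suc _)) =
  ≤-trans (prefixSum-update-≤ (atLeast k) m C i 1 z≤n) (bounded m k)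
prefixBounded-fire (fireS C v i j i<j ci cj) = prefixBounded-fireS v i j i<j ci cj

reachable⇒prefixBounded : {C D : Config n} → C ⟶G D → PrefixBounded C → PrefixBounded D
reachable⇒prefixBounded ε          bounded = bounded
reachable⇒prefixBounded (fire ◅ r) bounded = reachable⇒prefixBounded r (prefixBounded-fire fire bounded)

position-bound : {C : Config n} → PrefixBounded C → ∀ i → lookup C i ≤ suc (toℕ i)
position-bound {C = C} bounded i = ≤-pred (m∸n≢0⇒n<m (n>0⇒n≢0 (begin-strict
  0                                                   <⟨ s≤s z≤n ⟩
  1                                                   ≡⟨ atLeast-refl (lookup C i) ⟨
  atLeast (lookup C i) (lookup C i)                   ≤⟨ prefixSum-≥-entry _ (suc (toℕ i)) C i (n<1+n _) ⟩
  prefixSum (atLeast (lookup C i)) (suc (toℕ i)) C    ≤⟨ bounded (suc (toℕ i)) (lookup C i) ⟩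
  suc (suc (toℕ i)) ∸ lookup C i                      ∎)))
  where open ≤-Reasoning

-- Termination

potential : Config n → ℕ
potential {n} = prefixSum (λ x → x * x) n

fire-potential : {C D : Config n} → Fire C D → potential C < potential D
fire-potential {n} (fire0 C i ci) = ≤-reflexive (sym (begin
  potential (C [ i ]≔ 1)                          ≡⟨ +-identityʳ _ ⟨
  potential (C [ i ]≔ 1) + 0                      ≡⟨ cong (λ x → potential (C [ i ]≔ 1) + x * x) ci ⟨
  potential (C [ i ]≔ 1) + lookup C i * lookup C i ≡⟨ prefixSum-update (λ x → x * x) n C i 1 (Fin.toℕ<n i) ⟩
  potential C + 1                                 ≡⟨ +-comm _ 1 ⟩
  suc (potential C)                               ∎))
  where open ≡-Reasoning
fire-potential {n} (fireS C v i j i<j ci cj) = ≤-trans (n≤1+n _) (≤-reflexive (+-cancelʳ-≡ (s + s) _ _ (begin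
  (2 + P) + (s + s)                     ≡⟨ cong (_+ (s + s)) (+-comm 2 P) ⟩
  (P + 2) + (s + s)                     ≡⟨ +-assoc P 2 _ ⟩
  P + (2 + (s + s))                     ≡⟨ cong (P +_) (squares v) ⟨
  P + (v * v + suc (suc v) * suc (suc v)) ≡⟨ +-assoc P _ _ ⟨
  (P + v * v) + suc (suc v) * suc (suc v) ≡⟨ cong (_+ suc (suc v) * suc (suc v)) lower ⟨
  (P₁ + s) + suc (suc v) * suc (suc v)  ≡⟨ +-comm-middle P₁ s _ ⟩
  (P₁ + suc (suc v) * suc (suc v)) + s  ≡⟨ cong (_+ s) raise ⟨
  (P₂ + s) + s                          ≡⟨ +-assoc P₂ s s ⟩
  P₂ + (s + s)                          ∎)))
  where
  open ≡-Reasoning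
  square = λ x → x * x
  C₁ = C [ i ]≔ v
  P  = potential C
  P₁ = potential C₁
  P₂ = potential (C₁ [ j ]≔ suc (suc v))
  s  = suc v * suc v
  i≢j : i ≢ j
  i≢j refl = <-irrefl refl i<j
  lower : P₁ + s ≡ P + v * v
  lower = subst (λ x → P₁ + x * x ≡ P + v * v) ci (prefixSum-update square n C i v (Fin.toℕ<n i))
  raise : P₂ + s ≡ P₁ + suc (suc v) * suc (suc v)
  raise = subst (λ x → P₂ + x * x ≡ P₁ + suc (suc v) * suc (suc v))
    (trans (lookup∘update′ (i≢j ∘ sym) C v) cj) (prefixSum-update square n C₁ j (suc (suc v)) (Fin.toℕ<n j))
  squares : ∀ v → v * v + suc (suc v) * suc (suc v) ≡ 2 + (suc v * suc v + suc v * suc v)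
  squares = solve-∀
  +-comm-middle : ∀ a b c → (a + b) + c ≡ (a + c) + b
  +-comm-middle = solve-∀

potential-bound : {C : Config n} → PrefixBounded C → potential C ≤ n * (n * n)
potential-bound {n} {C} bounded = prefixSum-≤-* (λ x → x * x) n C (n * n) (λ i →
  let le = ≤-trans (position-bound bounded i) (Fin.toℕ<n i) in *-mono-≤ le le)

spread-or-fire : (C : Config n) → Spread C ⊎ ∃ (Fire C)
spread-or-fire C with Fin.any? (λ i → lookup C i ≟ 0)
... | yes (i , ci) = inj₂ (_ , fire0 C i ci)
... | no  none with Fin.any? (λ i → Fin.any? (λ j → (i Fin.<? j) ×-dec (lookup C i ≟ lookup C j)))
...   | yes (i , j , i<j , same) = inj₂ (fireAt (lookup C i) refl)
  where
  fireAt : ∀ x → lookup C i ≡ x → ∃ (Fire C)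
  fireAt zero    ci = ⊥-elim (none (i , ci))
  fireAt (suc v) ci = _ , fireS C v i j i<j ci (trans (sym same) ci)
...   | no  noPair = inj₁ ((λ i ci → none (i , ci)) , injective)
  where
  injective : Injective _≡_ _≡_ (lookup C)
  injective {i} {j} same with Fin.<-cmp i j
  ... | tri< i<j _ _ = ⊥-elim (noPair (i , j , i<j , same))
  ... | tri≈ _ i≡j _ = i≡j
  ... | tri> _ _ j<i = ⊥-elim (noPair (j , i , j<i , sym same))

stabilise : ∀ fuel (C : Config n) → PrefixBounded C → n * (n * n) < potential C + fuel →
  ∃ λ E → C ⟶G E × Spread E
stabilise zero C bounded room =
  ⊥-elim (<⇒≱ (<-≤-trans room (≤-reflexive (+-identityʳ _))) (potential-bound bounded))
stabilise (suc fuel) C bounded room with spread-or-fire C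
... | inj₁ spread     = C , ε , spread
... | inj₂ (D , fire) with stabilise fuel D (prefixBounded-fire fire bounded) (<-≤-trans room
      (≤-trans (≤-reflexive (+-suc _ fuel)) (+-monoˡ-≤ fuel (fire-potential fire))))
...   | E , D⟶E , spread = E , fire ◅ D⟶E , spread

-- The sorted stable configuration

staircase : (n : ℕ) → Config n
staircase n = tabulate (λ i → suc (toℕ i))

lookup-staircase : ∀ (i : Fin n) → lookup (staircase n) i ≡ suc (toℕ i)
lookup-staircase = lookup∘tabulate (λ i → suc (toℕ i))

staircase-spread : ∀ n → Spread (staircase n)
staircase-spread n =
  (λ i atZero → 1+n≢0 (trans (sym (lookup-staircase i)) atZero)) ,
  (λ {i} {j} same → Fin.toℕ-injective (suc-injective
     (trans (sym (lookup-staircase i)) (trans same (lookup-staircase j)))))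

position-forced : {C : Config n} → Spread C → PrefixBounded C → ∀ i →
  (∀ {j} → j F.< i → lookup C j ≡ suc (toℕ j)) → lookup C i ≡ suc (toℕ i)
position-forced {C = C} (noChipAt0 , injective) bounded i earlier = forced (lookup C i) refl
  where
  forced : ∀ x → lookup C i ≡ x → x ≡ suc (toℕ i)
  forced zero    ci = ⊥-elim (noChipAt0 i ci)
  forced (suc q) ci with q <? toℕ i
  ... | no  q≮i = cong suc (≤-antisym (≤-pred (subst (_≤ suc (toℕ i)) ci (position-bound bounded i)))
                                      (≮⇒≥ q≮i))
  ... | yes q<i = ⊥-elim (<-irrefl (trans (sym (Fin.toℕ-fromℕ< q<n)) (cong toℕ (injective clash))) q<i)
    where
    q<n = <-trans q<i (Fin.toℕ<n i)
    j = fromℕ< q<n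
    clash : lookup C j ≡ lookup C i
    clash = begin
      lookup C j     ≡⟨ earlier (subst (_< toℕ i) (sym (Fin.toℕ-fromℕ< q<n)) q<i) ⟩
      suc (toℕ j)    ≡⟨ cong suc (Fin.toℕ-fromℕ< q<n) ⟩
      suc q          ≡⟨ ci ⟨
      lookup C i     ∎
      where open ≡-Reasoning

spread⇒staircase : {C : Config n} → Spread C → PrefixBounded C → C ≡ staircase n
spread⇒staircase {n} {C} spread bounded = begin
  C                     ≡⟨ tabulate∘lookup C ⟨
  tabulate (lookup C)   ≡⟨ tabulate-cong (All.wfRec <-wellFounded 0ℓ _ (position-forced spread bounded)) ⟩
  staircase n           ∎
  where open ≡-Reasoning

Δ⟶staircase : ∀ n → Δ n ⟶G staircase n
Δ⟶staircase n with stabilise (suc (n * (n * n))) (Δ n) (prefixBounded-Δ n) (m≤n+m _ _)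
... | E , Δ⟶E , spread =
  subst (Δ n ⟶G_) (spread⇒staircase spread (reachable⇒prefixBounded Δ⟶E (prefixBounded-Δ n))) Δ⟶E

reachable-stable⇒staircase : {D : Config n} → Stable D → Δ n ⟶G D → D ≡ staircase n
reachable-stable⇒staircase {n} {D} stable Δ⟶D =
  spread⇒staircase (stable⇒spread {C = D} stable) (reachable⇒prefixBounded Δ⟶D (prefixBounded-Δ n))

proposition3p1 : (n : ℕ) → n ≥ 1 →
    Σ (Config n) (λ D →
      (Stable D × Δ n ⟶G D)
      × ((D′ : Config n) → Stable D′ → Δ n ⟶G D′ → D′ ≡ D)
      × ((i j : Fin n) → i F.≤ j → lookup D i ≤ lookup D j))
proposition3p1 n _ =
  staircase n ,
  (spread⇒stable {C = staircase n} (staircase-spread n) , Δ⟶staircase n) ,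
  (λ D → reachable-stable⇒staircase {D = D}) ,
  λ i j i≤j → subst₂ _≤_ (sym (lookup-staircase i)) (sym (lookup-staircase j)) (s≤s i≤j)
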